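{- Let $H$ be a digraph (possibly with loops) and $D$ an $H$-colored digraph such that for every vertex $x\in V(D)$ there exists an $xw$-$H$-walk for some vertex $w$ that is obstruction-free in $D$. Then $D$ has a kernel by $H$-walks.
   Context: An $H$-colored digraph is a finite digraph $D$ without loops with a coloring $\rho:A(D)\to V(H)$. A vertex $x$ is obstruction-free in $D$ if $(\rho(a),\rho(b))\in A(H)$ for every arc $a$ entering $x$ and every arc $b$ leaving $x$. An $H$-walk is a walk $(x_0,\ldots,x_n)$ such that $(\rho(x_{i-1},x_i),\rho(x_i,x_{i+1}))\in A(H)$ for every $i\in\{1,\ldots,n-1\}$. A kernel by $H$-walks is a set $S\subseteq V(D)$ such that there is no $H$-walk between two different vertices of $S$, and every vertex of $V(D)\setminus S$ has an $H$-walk to some vertex of $S$. -}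

module Defs where

open import Data.Nat using (ℕ)
open import Data.Fin using (Fin)
open import Data.Bool using (Bool; T)
open import Data.List using (List; []; _∷_)
open import Data.Product using (Σ; _×_; ∃-syntax)
open import Data.Unit using (⊤)
open import Data.Fin.Subset using (Subset; _∈_; _∉_)
open import Relation.Binary.PropositionalEquality using (_≡_; _≢_)
open import Relation.Nullary using (¬_)

-- An H-colored digraph D on vertex set Fin n: Boolean adjacency relation
-- 'arc' (required loopless in the theorem) and a coloring ρ of pairs of
-- vertices by vertices of H (only its values on arcs matter).

module _ {m n : ℕ} (HArc : Fin m → Fin m → Bool)
         (arc : Fin n → Fin n → Bool) (ρ : Fin n → Fin n → Fin m) where

  ObstructionFree : Fin n → Set
  ObstructionFree x = ∀ u v → T (arc u x) → T (arc x v) → T (HArc (ρ u x) (ρ x v))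

  IsHWalk : List (Fin n) → Set
  IsHWalk [] = ⊤
  IsHWalk (x ∷ []) = ⊤
  IsHWalk (x ∷ y ∷ []) = T (arc x y)
  IsHWalk (x ∷ y ∷ z ∷ rest) =
    T (arc x y) × T (HArc (ρ x y) (ρ y z)) × IsHWalk (y ∷ z ∷ rest)

  lastOf : Fin n → List (Fin n) → Fin n
  lastOf x [] = x
  lastOf x (y ∷ ys) = lastOf y ys

  HWalk : Fin n → Fin n → Set
  HWalk x y = Σ (List (Fin n)) λ xs → IsHWalk (x ∷ xs) × lastOf x xs ≡ y

  KernelByHWalks : Subset n → Set
  KernelByHWalks S =
    (∀ u v → u ∈ S → v ∈ S → u ≢ v → ¬ HWalk u v)
    × (∀ x → x ∉ S → ∃[ s ] (s ∈ S × HWalk x s))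

{-# OPTIONS --safe #-}
module Submission where

-- H-walks compose at obstruction-free vertices, so "x = y, or there is an
-- xy-H-walk ending at an obstruction-free y" is a preorder on V(D).  In a
-- finite preorder every element lies below a terminal class, and distinct
-- terminal classes are mutually unreachable.  The least-indexed members of
-- the terminal classes that are obstruction-free therefore form a kernel:
-- by hypothesis every vertex has an H-walk to an obstruction-free vertex,
-- and from there on to such a member.

open import Defs
open import Data.Nat using (ℕ)
open import Data.Fin using (Fin; _<_; _<?_)
open import Data.Fin.Properties using (all?; any?; <-cmp; <-trans; <-irrefl)
  renaming (_≟_ to _≟ᶠ_)
open import Data.Fin.Induction using (spo-noetherian)
open import Data.Fin.Subset using (Subset; _∈_; _∉_)
open import Data.Bool using (Bool; false; true; T)
open import Data.Product using (_×_; ∃-syntax; Σ; _,_; uncurry)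
open import Data.Sum using (_⊎_; inj₁; inj₂; [_,_])
open import Data.Unit using (tt)
open import Data.Empty using (⊥; ⊥-elim)
open import Data.List using (List; []; _∷_; _++_; map; allFin; cartesianProduct)
open import Data.List.Relation.Unary.Any using (here; there)
import Data.List.Membership.Propositional as List
open import Data.List.Membership.Propositional.Properties
  using (∈-allFin; ∈-map⁺; ∈-++⁺ˡ; ∈-++⁺ʳ; ∈-cartesianProduct⁺)
open import Data.Vec using (tabulate)
open import Data.Vec.Properties using (lookup∘tabulate; []=⇒lookup; lookup⇒[]=)
open import Function using (flip)
open import Induction.WellFounded using (Acc; acc)
open import Relation.Binary using (Rel; Decidable; IsPreorder; IsStrictPartialOrder;
  tri<; tri≈; tri>)
open import Relation.Binary.PropositionalEquality
  using (_≡_; _≢_; refl; sym; trans; resp₂; isEquivalence)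
open import Relation.Nullary using (¬_; Dec; yes; no; does)
open import Relation.Nullary.Decidable
  using (_×-dec_; _⊎-dec_; _→-dec_; ¬?; T?; dec-true; decidable-stable)

module Reachability {V : Set} (_⟶_ : V → V → Set) (_⟶?_ : Decidable _⟶_) where

  data Path (L : List V) : V → V → Set where
    edge : ∀ {s t} → s ⟶ t → Path L s t
    step : ∀ {s u t} → s ⟶ u → u List.∈ L → Path L u t → Path L s t

  weaken : ∀ {k L s t} → Path L s t → Path (k ∷ L) s t
  weaken (edge e)       = edge e
  weaken (step e u∈L p) = step e (there u∈L) (weaken p)

  join : ∀ {L s k t} → Path L s k → k List.∈ L → Path L k t → Path L s t
  join (edge e)       k∈L q = step e k∈L q
  join (step e u∈L p) k∈L q = step e u∈L (join p k∈L q)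

  split : ∀ {k L s t} → Path (k ∷ L) s t → Path L s t ⊎ (Path L s k × Path L k t)
  split (edge e) = inj₁ (edge e)
  split (step e (here refl) p) with split p
  ... | inj₁ q       = inj₂ (edge e , q)
  ... | inj₂ (_ , q) = inj₂ (edge e , q)
  split (step e (there u∈L) p) with split p
  ... | inj₁ q       = inj₁ (step e u∈L q)
  ... | inj₂ (q , r) = inj₂ (step e u∈L q , r)

  -- Floyd–Warshall: admit the inner vertices of L one at a time.
  path? : ∀ L s t → Dec (Path L s t)
  path? [] s t with s ⟶? t
  ... | yes e = yes (edge e)
  ... | no ¬e = no λ { (edge e) → ¬e e ; (step _ () _) }
  path? (k ∷ L) s t with path? L s t | path? L s k | path? L k t
  ... | yes p | _     | _     = yes (weaken p)
  ... | no _  | yes p | yes q = yes (join (weaken p) (here refl) (weaken q))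
  ... | no ¬p | no ¬q | _     = no λ r → [ ¬p , (λ (q , _) → ¬q q) ] (split r)
  ... | no ¬p | yes _ | no ¬q = no λ r → [ ¬p , (λ (_ , q) → ¬q q) ] (split r)

module FiniteStrictOrder {n ℓ} {_⊏_ : Rel (Fin n) ℓ}
  (isSPO : IsStrictPartialOrder _≡_ _⊏_) (_⊏?_ : Decidable _⊏_) where

  open IsStrictPartialOrder isSPO using () renaming (trans to ⊏-trans)

  Maximal : Fin n → Set ℓ
  Maximal k = ∀ y → ¬ k ⊏ y

  maximal? : ∀ k → Dec (Maximal k)
  maximal? k = all? λ y → ¬? (k ⊏? y)

  maximal-above : ∀ x → ∃[ k ] ((x ≡ k ⊎ x ⊏ k) × Maximal k)
  maximal-above x = climb x (spo-noetherian isSPO x)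
    where
    climb : ∀ x → Acc (flip _⊏_) x → ∃[ k ] ((x ≡ k ⊎ x ⊏ k) × Maximal k)
    climb x (acc above) with any? (x ⊏?_)
    ... | no ¬x⊏ = x , inj₁ refl , λ y x⊏y → ¬x⊏ (y , x⊏y)
    ... | yes (y , x⊏y) with climb y (above x⊏y)
    ... | k , y⊑k , max =
      k , inj₂ ([ (λ { refl → x⊏y }) , ⊏-trans x⊏y ] y⊑k) , max

module FinitePreorder {n ℓ} {_≲_ : Rel (Fin n) ℓ}
  (isPreorder : IsPreorder _≡_ _≲_) (_≲?_ : Decidable _≲_) where

  open IsPreorder isPreorder using (reflexive) renaming (trans to ≲-trans)

  -- Ties inside a ≲-class are broken by index, so the ⊏-maximal elements are
  -- the least-indexed members of the terminal classes.
  _⊏_ : Rel (Fin n) ℓ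
  x ⊏ y = x ≲ y × (¬ y ≲ x ⊎ y < x)

  ⊏-trans : ∀ {x y z} → x ⊏ y → y ⊏ z → x ⊏ z
  ⊏-trans (x≲y , inj₁ y≴x) (y≲z , _) =
    ≲-trans x≲y y≲z , inj₁ λ z≲x → y≴x (≲-trans y≲z z≲x)
  ⊏-trans (x≲y , inj₂ _) (y≲z , inj₁ z≴y) =
    ≲-trans x≲y y≲z , inj₁ λ z≲x → z≴y (≲-trans z≲x x≲y)
  ⊏-trans (x≲y , inj₂ y<x) (y≲z , inj₂ z<y) =
    ≲-trans x≲y y≲z , inj₂ (<-trans z<y y<x)

  ⊏-isStrictPartialOrder : IsStrictPartialOrder _≡_ _⊏_
  ⊏-isStrictPartialOrder = record
    { isEquivalence = isEquivalence
    ; irrefl        = λ { refl (x≲x , x≴x⊎x<x) →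
                          [ (λ x≴x → x≴x x≲x) , <-irrefl refl ] x≴x⊎x<x }
    ; trans         = ⊏-trans
    ; <-resp-≈      = resp₂ _⊏_
    }

  _⊏?_ : Decidable _⊏_
  x ⊏? y = (x ≲? y) ×-dec (¬? (y ≲? x) ⊎-dec (y <? x))

  open FiniteStrictOrder ⊏-isStrictPartialOrder _⊏?_ public
    using (Maximal; maximal?)

  maximal-≲ : ∀ x → ∃[ k ] (x ≲ k × Maximal k)
  maximal-≲ x with FiniteStrictOrder.maximal-above ⊏-isStrictPartialOrder _⊏?_ x
  ... | k , x≡k⊎x⊏k , max = k , [ reflexive , (λ (x≲k , _) → x≲k) ] x≡k⊎x⊏k , max

  maximal-≲-unique : ∀ {k k′} → Maximal k → Maximal k′ → k ≲ k′ → k ≡ k′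
  maximal-≲-unique {k} {k′} max max′ k≲k′
    with decidable-stable (k′ ≲? k) (λ k′≴k → max k′ (k≲k′ , inj₁ k′≴k)) | <-cmp k k′
  ... | k′≲k | tri< k<k′ _ _ = ⊥-elim (max′ k (k′≲k , inj₂ k<k′))
  ... | _    | tri≈ _ k≡k′ _ = k≡k′
  ... | _    | tri> _ _ k′<k = ⊥-elim (max k′ (k≲k′ , inj₂ k′<k))

decSubset : ∀ {n ℓ} {P : Fin n → Set ℓ} → (∀ x → Dec (P x)) → Subset n
decSubset P? = tabulate λ x → does (P? x)

module _ {n ℓ} {P : Fin n → Set ℓ} (P? : ∀ x → Dec (P x)) where

  ∈-decSubset⁺ : ∀ {x} → P x → x ∈ decSubset P?
  ∈-decSubset⁺ {x} px =
    lookup⇒[]= x _ (trans (lookup∘tabulate _ x) (dec-true (P? x) px))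

  ∈-decSubset⁻ : ∀ {x} → x ∈ decSubset P? → P x
  ∈-decSubset⁻ {x} x∈ =
    does-true (P? x) (trans (sym (lookup∘tabulate _ x)) ([]=⇒lookup x∈))
    where
    does-true : (a? : Dec (P x)) → does a? ≡ true → P x
    does-true (yes a) _ = a

module HWalks {m n : ℕ} (HArc : Fin m → Fin m → Bool)
  (arc : Fin n → Fin n → Bool) (ρ : Fin n → Fin n → Fin m) where

  Walk : List (Fin n) → Set
  Walk = IsHWalk HArc arc ρ

  last : Fin n → List (Fin n) → Fin n
  last = lastOf HArc arc ρ

  _⇝_ : Fin n → Fin n → Set
  _⇝_ = HWalk HArc arc ρ

  Free : Fin n → Set
  Free = ObstructionFree HArc arc ρ

  free? : ∀ x → Dec (Free x)
  free? x = all? λ u → all? λ v →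
    T? (arc u x) →-dec (T? (arc x v) →-dec T? (HArc (ρ u x) (ρ x v)))

  walk-head : ∀ x y rest → Walk (x ∷ y ∷ rest) → T (arc x y)
  walk-head x y []      xy       = xy
  walk-head x y (_ ∷ _) (xy , _) = xy

  last-++ : ∀ x xs ys → last x (xs ++ ys) ≡ last (last x xs) ys
  last-++ x []       ys = refl
  last-++ x (y ∷ xs) ys = last-++ y xs ys

  walk-++ : ∀ x xs ys → Walk (x ∷ xs) → Free (last x xs) → Walk (last x xs ∷ ys) →
            Walk (x ∷ xs ++ ys)
  walk-++ x []           ys        _          _    w′ = w′
  walk-++ x (y ∷ [])     []        w          _    _  = w
  walk-++ x (y ∷ [])     (z ∷ zs)  xy         free w′ =
    xy , free x z xy (walk-head y z zs w′) , w′
  walk-++ x (y ∷ y′ ∷ xs) ys       (xy , h , w) free w′ =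
    xy , h , walk-++ y (y′ ∷ xs) ys w free w′

  ⇝-trans : ∀ {x y z} → x ⇝ y → Free y → y ⇝ z → x ⇝ z
  ⇝-trans {x} (xs , w , refl) free (ys , w′ , refl) =
    xs ++ ys , walk-++ x xs ys w free w′ , last-++ x xs ys

  -- An H-walk as a path in the graph of traversed arcs, framed by its two ends.
  data Stage : Set where
    source    : Fin n → Stage
    traversed : Fin n → Fin n → Stage
    target    : Fin n → Stage

  _⟶_ : Stage → Stage → Set
  source x      ⟶ traversed a b = x ≡ a × T (arc a b)
  source x      ⟶ target y      = x ≡ y
  traversed a b ⟶ traversed c d = b ≡ c × T (arc c d) × T (HArc (ρ a b) (ρ c d))
  traversed a b ⟶ target y      = b ≡ y
  _             ⟶ _             = ⊥

  _⟶?_ : Decidable _⟶_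
  source x      ⟶? traversed a b = (x ≟ᶠ a) ×-dec T? (arc a b)
  source x      ⟶? target y      = x ≟ᶠ y
  traversed a b ⟶? traversed c d =
    (b ≟ᶠ c) ×-dec (T? (arc c d) ×-dec T? (HArc (ρ a b) (ρ c d)))
  traversed a b ⟶? target y      = b ≟ᶠ y
  source _      ⟶? source _      = no λ ()
  traversed _ _ ⟶? source _      = no λ ()
  target _      ⟶? _             = no λ ()

  open Reachability _⟶_ _⟶?_

  stages : List Stage
  stages = map source (allFin n) ++ map target (allFin n)
        ++ map (uncurry traversed) (cartesianProduct (allFin n) (allFin n))

  ∈-stages : ∀ s → s List.∈ stages
  ∈-stages (source x) = ∈-++⁺ˡ (∈-map⁺ source (∈-allFin x))
  ∈-stages (target x) =
    ∈-++⁺ʳ (map source (allFin n)) (∈-++⁺ˡ (∈-map⁺ target (∈-allFin x)))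
  ∈-stages (traversed a b) =
    ∈-++⁺ʳ (map source (allFin n)) (∈-++⁺ʳ (map target (allFin n))
      (∈-map⁺ (uncurry traversed) (∈-cartesianProduct⁺ (∈-allFin a) (∈-allFin b))))

  Reach : Stage → Stage → Set
  Reach = Path stages

  reach-from-arc : ∀ a b rest {y} → Walk (a ∷ b ∷ rest) → last b rest ≡ y →
                   Reach (traversed a b) (target y)
  reach-from-arc a b []       _           b≡y = edge b≡y
  reach-from-arc a b (c ∷ cs) (_ , h , w) c≡y =
    step (refl , walk-head b c cs w , h) (∈-stages _) (reach-from-arc b c cs w c≡y)

  ⇝⇒reach : ∀ {x y} → x ⇝ y → Reach (source x) (target y)
  ⇝⇒reach ([]     , _ , x≡y) = edge x≡y
  ⇝⇒reach {x} (b ∷ rest , w , e) =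
    step (refl , walk-head x b rest w) (∈-stages _) (reach-from-arc x b rest w e)

  target-stuck : ∀ {y s} → ¬ Reach (target y) s
  target-stuck (edge ())
  target-stuck (step () _ _)

  walk-from-arc : ∀ {a b y} → T (arc a b) → Reach (traversed a b) (target y) →
                  Σ (List (Fin n)) λ rest → Walk (a ∷ b ∷ rest) × last b rest ≡ y
  walk-from-arc ab (edge b≡y) = [] , ab , b≡y
  walk-from-arc ab (step {u = target _} _ _ r) = ⊥-elim (target-stuck r)
  walk-from-arc ab (step {u = traversed _ d} (refl , cd , h) _ r)
    with walk-from-arc cd r
  ... | rest , w , e = d ∷ rest , (ab , h , w) , e

  reach⇒⇝ : ∀ {x y} → Reach (source x) (target y) → x ⇝ y
  reach⇒⇝ (edge x≡y) = [] , tt , x≡y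
  reach⇒⇝ (step {u = target _} _ _ r) = ⊥-elim (target-stuck r)
  reach⇒⇝ (step {u = traversed _ b} (refl , ab) _ r) with walk-from-arc ab r
  ... | rest , w , e = b ∷ rest , w , e

  _⇝?_ : ∀ x y → Dec (x ⇝ y)
  x ⇝? y with path? stages (source x) (target y)
  ... | yes r = yes (reach⇒⇝ r)
  ... | no ¬r = no λ p → ¬r (⇝⇒reach p)

  _≲_ : Fin n → Fin n → Set
  x ≲ y = x ≡ y ⊎ (x ⇝ y × Free y)

  ≲-isPreorder : IsPreorder _≡_ _≲_
  ≲-isPreorder = record
    { isEquivalence = isEquivalence
    ; reflexive     = inj₁
    ; trans         = λ
      { (inj₁ refl) y≲z → y≲z
      ; x≲y (inj₁ refl) → x≲y
      ; (inj₂ (x⇝y , free-y)) (inj₂ (y⇝z , free-z)) →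
          inj₂ (⇝-trans x⇝y free-y y⇝z , free-z)
      }
    }

  _≲?_ : Decidable _≲_
  x ≲? y = (x ≟ᶠ y) ⊎-dec ((x ⇝? y) ×-dec free? y)

  open FinitePreorder ≲-isPreorder _≲?_

  InKernel : Fin n → Set
  InKernel k = Free k × Maximal k

  kernel? : ∀ k → Dec (InKernel k)
  kernel? k = free? k ×-dec maximal? k

  kernel : Subset n
  kernel = decSubset kernel?

  kernel-independent : ∀ u v → u ∈ kernel → v ∈ kernel → u ≢ v → ¬ u ⇝ v
  kernel-independent u v u∈ v∈ u≢v u⇝v
    with ∈-decSubset⁻ kernel? u∈ | ∈-decSubset⁻ kernel? v∈
  ... | _ , max-u | free-v , max-v =
    u≢v (maximal-≲-unique max-u max-v (inj₂ (u⇝v , free-v)))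

  kernel-absorbing : (∀ x → ∃[ w ] (x ⇝ w × Free w)) →
                     ∀ x → ∃[ k ] (k ∈ kernel × x ⇝ k)
  kernel-absorbing reaches-free x with reaches-free x
  ... | w , x⇝w , free-w with maximal-≲ w
  ... | k , inj₁ refl , max = k , ∈-decSubset⁺ kernel? (free-w , max) , x⇝w
  ... | k , inj₂ (w⇝k , free-k) , max =
    k , ∈-decSubset⁺ kernel? (free-k , max) , ⇝-trans x⇝w free-w w⇝k

theorem4 : (m : ℕ) (HArc : Fin m → Fin m → Bool)
    (n : ℕ) (arc : Fin n → Fin n → Bool) (ρ : Fin n → Fin n → Fin m) →
    (∀ x → arc x x ≡ false) →
    (∀ x → ∃[ w ] (HWalk HArc arc ρ x w × ObstructionFree HArc arc ρ w)) →
    ∃[ S ] KernelByHWalks HArc arc ρ S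
theorem4 m HArc n arc ρ _ reaches-free =
  kernel , kernel-independent , λ x _ → kernel-absorbing reaches-free x
  where open HWalks HArc arc ρ
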